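{- Let $P$ be a Bayesian network on $\{0,1\}^d$ with graph $G$ and conditional probability table $p$, and let $X\sim P$. Then $\mathbb{E}[F(X,p)]=p$, and the covariance matrix of $F(X,p)$ is $\mathrm{Cov}[F(X,p)]=\mathrm{diag}\big(\Pr_P[\Pi_k]\,p_k(1-p_k)\big)_{k=1}^m$.
   Context: Fix a directed acyclic graph $G$ on $[d]$ with all edges from smaller to larger indices. A distribution $P$ on $\{0,1\}^d$ is a Bayesian network with graph $G$ if for each $i$, $\Pr_{X\sim P}[X_i=1\mid X_1,\dots,X_{i-1}]$ depends only on $X_j$ for $j$ a parent of $i$. Let $S=\{(i,a):1\le i\le d,\ a\in\{0,1\}^{\mathrm{Parents}(i)}\}$, $m=|S|$, indexed by $k=1,\dots,m$ lexicographically; $\Pi_k=\Pi_{i,a}$ is the event $X_{\mathrm{Parents}(i)}=a$. The conditional probability table $p$ has $p_{i,a}=\Pr_{X\sim P}[X_i=1\mid\Pi_{i,a}]$. For $x\in\{0,1\}^d$ and $q\in\mathbb{R}^m$, $F(x,q)\in\mathbb{R}^m$ is defined by $F(x,q)_{i,a}=x_i$ if $x\in\Pi_{i,a}$ and $F(x,q)_{i,a}=q_{i,a}$ otherwise. -}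

module Defs where

open import Level using (Level; _⊔_) renaming (suc to lsuc)
open import Relation.Binary.Core using (Rel)
open import Relation.Binary.Structures using (IsTotalOrder)
open import Relation.Nullary using (¬_)
open import Algebra.Bundles using (CommutativeRing)
open import Data.Bool using (Bool; true; false; if_then_else_; _∧_; not)
open import Data.Nat using (ℕ; zero; suc; _<ᵇ_)
open import Data.Fin as Fin using (Fin; toℕ)
open import Data.Vec as V using (Vec; lookup)
open import Data.List as L using (List)
open import Data.Bool.ListAction using (and)
open import Data.List.Relation.Unary.All using (All)
open import Data.List.Relation.Unary.Unique.Propositional using (Unique)
open import Data.Product using (Σ; _×_; _,_; proj₁)

-- A DAG on [d] = Fin d, given by parent lists; every parent of i is
-- strictly smaller than i (edges go from smaller to larger indices).
record DAG (d : ℕ) : Set where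
  field
    parents        : Fin d → List (Fin d)
    parents-unique : ∀ i → Unique (parents i)
    parents-below  : ∀ i → All (Fin._< i) (parents i)

open DAG public

npar : ∀ {d} → DAG d → Fin d → ℕ
npar G i = L.length (parents G i)

Idx : ∀ {d} → DAG d → Set
Idx G = Σ (Fin _) λ i → Vec Bool (npar G i)

allVecs : (n : ℕ) → List (Vec Bool n)
allVecs zero    = L.[ V.[] ]
allVecs (suc n) = L.concatMap (λ v → (false V.∷ v) L.∷ (true V.∷ v) L.∷ L.[]) (allVecs n)

eqB : Bool → Bool → Bool
eqB a b = if a then b else not b

eqVec : ∀ {n} → Vec Bool n → Vec Bool n → Bool
eqVec V.[]       V.[]       = true
eqVec (a V.∷ as) (b V.∷ bs) = eqB a b ∧ eqVec as bs

restr : ∀ {d} (G : DAG d) → Vec Bool d → (i : Fin d) → Vec Bool (npar G i)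
restr G x i = V.map (lookup x) (V.fromList (parents G i))

inΠ : ∀ {d} (G : DAG d) → Vec Bool d → Idx G → Bool
inΠ G x (i , a) = eqVec (restr G x i) a

agreeBelow : ∀ {d} → Fin d → Vec Bool d → Vec Bool d → Bool
agreeBelow {d} i x y =
  and (L.map (λ j → if toℕ j <ᵇ toℕ i then eqB (lookup x j) (lookup y j) else true) (L.allFin d))

-- The scalars: an abstract totally ordered commutative ring whose product of
-- positive elements is positive (ℝ being the intended instance).
record OrderedCommRing (c ℓ ℓ' : Level) : Set (lsuc (c ⊔ ℓ ⊔ ℓ')) where
  field
    commutativeRing : CommutativeRing c ℓ
  open CommutativeRing commutativeRing
  field
    _≤_          : Rel Carrier ℓ'
    isTotalOrder : IsTotalOrder _≈_ _≤_
  _<_ : Rel Carrier (ℓ ⊔ ℓ')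
  a < b = (a ≤ b) × ¬ (a ≈ b)
  field
    +-monoˡ-≤ : ∀ {a b} e → a ≤ b → (a + e) ≤ (b + e)
    *-nonneg  : ∀ {a b} → 0# ≤ a → 0# ≤ b → 0# ≤ (a * b)
    *-pos     : ∀ {a b} → 0# < a → 0# < b → 0# < (a * b)

module WithRing {c ℓ ℓ'} (O : OrderedCommRing c ℓ ℓ') where
  open OrderedCommRing O using (_≤_)
  open CommutativeRing (OrderedCommRing.commutativeRing O)

  ind : Bool → Carrier
  ind true  = 1#
  ind false = 0#

  sumAll : ∀ {d} → (Vec Bool d → Carrier) → Carrier
  sumAll {d} f = L.foldr (λ x acc → f x + acc) 0# (allVecs d)

  Pr : ∀ {d} → (Vec Bool d → Carrier) → (Vec Bool d → Bool) → Carrier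
  Pr P E = sumAll λ x → if E x then P x else 0#

  𝔼 : ∀ {d} → (Vec Bool d → Carrier) → (Vec Bool d → Carrier) → Carrier
  𝔼 P f = sumAll λ x → P x * f x

  IsDistribution : ∀ {d} → (Vec Bool d → Carrier) → Set (ℓ ⊔ ℓ')
  IsDistribution P = (∀ x → 0# ≤ P x) × (sumAll P ≈ 1#)

  -- P is a Bayesian network with graph G: P is a distribution and for each i,
  -- Pr[X_i = 1 | X_1..X_{i-1}] depends only on X_{Parents(i)}; stated without
  -- division: Pr[X_{<i} = y_{<i}, X_i = 1] = g_i(y_{Parents(i)}) · Pr[X_{<i} = y_{<i}].
  IsBayesNet : ∀ {d} → DAG d → (Vec Bool d → Carrier) → Set (c ⊔ ℓ ⊔ ℓ')
  IsBayesNet G P =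
    IsDistribution P ×
    (∀ i → Σ (Vec Bool (npar G i) → Carrier) λ g → ∀ (y : Vec Bool _) →
      Pr P (λ x → agreeBelow i x y ∧ lookup x i)
        ≈ g (restr G y i) * Pr P (λ x → agreeBelow i x y))

  -- p is the conditional probability table: p_{i,a} = Pr[X_i = 1 | Π_{i,a}],
  -- stated as Pr[Π_{i,a} ∧ X_i = 1] = p_{i,a} · Pr[Π_{i,a}].
  IsCPT : ∀ {d} (G : DAG d) → (Vec Bool d → Carrier) → (Idx G → Carrier) → Set ℓ
  IsCPT G P p = ∀ k → Pr P (λ x → inΠ G x k ∧ lookup x (proj₁ k)) ≈ p k * Pr P (λ x → inΠ G x k)

  F : ∀ {d} (G : DAG d) → Vec Bool d → (Idx G → Carrier) → Idx G → Carrier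
  F G x q k = if inΠ G x k then ind (lookup x (proj₁ k)) else q k

  Mean : ∀ {d} {K : Set} → (Vec Bool d → Carrier) → (Vec Bool d → K → Carrier) → K → Carrier
  Mean P Y k = 𝔼 P (λ x → Y x k)

  Cov : ∀ {d} {K : Set} → (Vec Bool d → Carrier) → (Vec Bool d → K → Carrier) → K → K → Carrier
  Cov P Y k l = 𝔼 P (λ x → (Y x k - Mean P Y k) * (Y x l - Mean P Y l))

module Submission where

-- Write D_k(x) = 1[x ∈ Π_k] (x_i - p_k) for k = (i,a), so that F(x,p)_k = p_k + D_k(x).
--   * The CPT identity Pr[Π_k ∧ X_i] = p_k Pr[Π_k] says exactly E[D_k] = 0;
--     this gives the mean, and reduces every covariance to E[D_k D_l].
--   * Diagonal: for X_i ∈ {0,1}, D_k² = (1 - 2p_k) D_k + p_k(1 - p_k) 1[Π_k].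
--   * Same node, different a: the events Π_(i,a), Π_(i,b) are disjoint.
--   * Nodes j < i: the network condition gives the tower property
--     E[c(X) (X_i - g_i(X_Parents(i)))] = 0 for every c depending only on X_<i,
--     proved by summing over the fibres of the prefix map x ↦ x_<i.  Hence
--     E[c D_k] = (g_i(a) - p_k) E[c 1[Π_k]] for such c.  With c = 1 and
--     positivity of P this forces (g_i(a) - p_k) P(x) 1[Π_k](x) = 0 for all x;
--     with c = D_l it then gives E[D_l D_k] = 0.

open import Defs
open import Algebra.Bundles using (CommutativeRing)
open import Data.Bool using (Bool)
open import Data.Vec using (Vec)
open import Data.Product using (_×_)
open import Relation.Binary.PropositionalEquality using (_≢_)

open import Data.Bool using (true; false; _∧_; if_then_else_; T)
open import Data.Bool.Properties using (T-≡)
open import Data.Maybe using (Maybe; just; nothing)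
open import Data.Nat as ℕ using (ℕ; zero; suc)
import Data.Nat.Properties as ℕP
open import Data.Integer as ℤ using (ℤ; +_; -[1+_]; _⊖_)
import Data.Integer.Properties as ℤP
open import Data.Sign as Sign using (Sign)
open import Data.Fin as Fin using (Fin; toℕ)
import Data.Fin.Properties as FinP
import Data.Vec as V
import Data.Vec.Properties as VP
import Data.List as L
open import Data.List using (List; []; _∷_)
open import Data.List.Membership.Propositional.Properties using (∈-allFin)
import Data.List.Relation.Unary.All as All
open import Data.List.Relation.Unary.All.Properties using (all⁺; all⁻)
open import Data.Product using (_,_; proj₁; proj₂)
open import Data.Sum using (inj₁; inj₂)
open import Data.Empty using (⊥; ⊥-elim)
open import Data.Unit using (tt)
open import Function.Base using (_∘′_)
open import Function.Bundles using (Equivalence)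
open import Relation.Binary.PropositionalEquality as ≡ using (_≡_)
open import Relation.Binary.Structures using (IsTotalOrder)
open import Relation.Binary.Definitions using (tri<; tri≈; tri>)
open import Relation.Nullary using (yes; no)
import Algebra.Properties.Ring as RingProperties
import Algebra.Properties.CommutativeSemigroup as CommSemigroupProperties
import Algebra.Properties.Semiring.Mult.TCOptimised as Multiples
import Algebra.Solver.Ring.AlmostCommutativeRing as ACR
import Algebra.Solver.Ring as RingSolver
import Relation.Binary.Reasoning.Setoid as SetoidReasoning

-- The canonical map ℤ → R (n ↦ n·1) is a ring homomorphism, and equality of
-- integers is decidable, so Algebra.Solver.Ring applies with ℤ as coefficients.
module IntegerSolver {c ℓ} (R : CommutativeRing c ℓ) where
  open CommutativeRing R
  open RingProperties ring using (-0#≈0#; -‿involutive; -‿+-comm; -‿distribˡ-*; -‿distribʳ-*)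
  open Multiples semiring using (×-homo-+; ×1-homo-*; 1+×) renaming (_×_ to _×ₙ_)
  open SetoidReasoning setoid

  ⟦_⟧ₙ : ℕ → Carrier
  ⟦ n ⟧ₙ = n ×ₙ 1#

  ⟦_⟧ : ℤ → Carrier
  ⟦ + n ⟧      = ⟦ n ⟧ₙ
  ⟦ -[1+ n ] ⟧ = - ⟦ suc n ⟧ₙ

  ⊖-homo : ∀ m n → ⟦ m ⊖ n ⟧ ≈ ⟦ m ⟧ₙ - ⟦ n ⟧ₙ
  ⊖-homo m       zero    = sym (trans (+-congˡ -0#≈0#) (+-identityʳ _))
  ⊖-homo zero    (suc n) = sym (+-identityˡ _)
  ⊖-homo (suc m) (suc n) = begin
    ⟦ suc m ⊖ suc n ⟧                       ≡⟨ ≡.cong ⟦_⟧ (ℤP.[1+m]⊖[1+n]≡m⊖n m n) ⟩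
    ⟦ m ⊖ n ⟧                               ≈⟨ ⊖-homo m n ⟩
    ⟦ m ⟧ₙ - ⟦ n ⟧ₙ                         ≈⟨ +-identityˡ _ ⟨
    0# + (⟦ m ⟧ₙ - ⟦ n ⟧ₙ)                  ≈⟨ +-congʳ (-‿inverseʳ 1#) ⟨
    (1# - 1#) + (⟦ m ⟧ₙ - ⟦ n ⟧ₙ)           ≈⟨ CommSemigroupProperties.interchange +-commutativeSemigroup _ _ _ _ ⟩
    (1# + ⟦ m ⟧ₙ) + (- 1# - ⟦ n ⟧ₙ)         ≈⟨ +-congˡ (-‿+-comm 1# ⟦ n ⟧ₙ) ⟩
    (1# + ⟦ m ⟧ₙ) - (1# + ⟦ n ⟧ₙ)           ≈⟨ +-cong (1+× m 1#) (-‿cong (1+× n 1#)) ⟨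
    ⟦ suc m ⟧ₙ - ⟦ suc n ⟧ₙ                 ∎

  +-homo : ∀ i j → ⟦ i ℤ.+ j ⟧ ≈ ⟦ i ⟧ + ⟦ j ⟧
  +-homo (+ m)    (+ n)    = ×-homo-+ 1# m n
  +-homo (+ m)    -[1+ n ] = ⊖-homo m (suc n)
  +-homo -[1+ m ] (+ n)    = trans (⊖-homo n (suc m)) (+-comm _ _)
  +-homo -[1+ m ] -[1+ n ] = begin
    - ⟦ suc (suc (m ℕ.+ n)) ⟧ₙ    ≡⟨ ≡.cong (λ k → - ⟦ k ⟧ₙ) (≡.sym (ℕP.+-suc (suc m) n)) ⟩
    - ⟦ suc m ℕ.+ suc n ⟧ₙ        ≈⟨ -‿cong (×-homo-+ 1# (suc m) (suc n)) ⟩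
    - (⟦ suc m ⟧ₙ + ⟦ suc n ⟧ₙ)   ≈⟨ -‿+-comm _ _ ⟨
    - ⟦ suc m ⟧ₙ - ⟦ suc n ⟧ₙ     ∎

  -‿homo : ∀ i → ⟦ ℤ.- i ⟧ ≈ - ⟦ i ⟧
  -‿homo (+ zero)  = sym -0#≈0#
  -‿homo (+ suc n) = refl
  -‿homo -[1+ n ]  = sym (-‿involutive _)

  -- A sign acting on R, used to reduce multiplication to ℕ via ∣_∣ and sign.
  signed : Sign → Carrier → Carrier
  signed Sign.+ x = x
  signed Sign.- x = - x

  signed-cong : ∀ s {x y} → x ≈ y → signed s x ≈ signed s y
  signed-cong Sign.+ e = e
  signed-cong Sign.- e = -‿cong e

  ◃-homo : ∀ s n → ⟦ s ℤ.◃ n ⟧ ≈ signed s ⟦ n ⟧ₙ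
  ◃-homo Sign.+ zero    = refl
  ◃-homo Sign.- zero    = sym -0#≈0#
  ◃-homo Sign.+ (suc n) = refl
  ◃-homo Sign.- (suc n) = refl

  signed-* : ∀ s t x y → signed (s Sign.* t) (x * y) ≈ signed s x * signed t y
  signed-* Sign.+ Sign.+ x y = refl
  signed-* Sign.+ Sign.- x y = -‿distribʳ-* x y
  signed-* Sign.- Sign.+ x y = -‿distribˡ-* x y
  signed-* Sign.- Sign.- x y = begin
    x * y           ≈⟨ -‿involutive _ ⟨
    - - (x * y)     ≈⟨ -‿cong (-‿distribˡ-* x y) ⟩
    - (- x * y)     ≈⟨ -‿distribʳ-* (- x) y ⟩
    - x * - y       ∎

  sign-abs : ∀ i → ⟦ i ⟧ ≈ signed (ℤ.sign i) ⟦ ℤ.∣ i ∣ ⟧ₙ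
  sign-abs (+ n)    = refl
  sign-abs -[1+ n ] = refl

  *-homo : ∀ i j → ⟦ i ℤ.* j ⟧ ≈ ⟦ i ⟧ * ⟦ j ⟧
  *-homo i j = begin
    ⟦ i ℤ.* j ⟧                               ≈⟨ ◃-homo s (ℤ.∣ i ∣ ℕ.* ℤ.∣ j ∣) ⟩
    signed s ⟦ ℤ.∣ i ∣ ℕ.* ℤ.∣ j ∣ ⟧ₙ         ≈⟨ signed-cong s (×1-homo-* ℤ.∣ i ∣ ℤ.∣ j ∣) ⟩
    signed s (⟦ ℤ.∣ i ∣ ⟧ₙ * ⟦ ℤ.∣ j ∣ ⟧ₙ)    ≈⟨ signed-* (ℤ.sign i) (ℤ.sign j) _ _ ⟩
    signed (ℤ.sign i) ⟦ ℤ.∣ i ∣ ⟧ₙ * signed (ℤ.sign j) ⟦ ℤ.∣ j ∣ ⟧ₙ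
                                               ≈⟨ *-cong (sign-abs i) (sign-abs j) ⟨
    ⟦ i ⟧ * ⟦ j ⟧                             ∎
    where s = ℤ.sign i Sign.* ℤ.sign j

  ℤ⟶R : ℤ.+-*-rawRing ACR.-Raw-AlmostCommutative⟶ ACR.fromCommutativeRing R
  ℤ⟶R = record
    { ⟦_⟧ = ⟦_⟧ ; +-homo = +-homo ; *-homo = *-homo ; -‿homo = -‿homo
    ; 0-homo = refl ; 1-homo = refl }

  ℤ-equal? : ∀ i j → Maybe (⟦ i ⟧ ≈ ⟦ j ⟧)
  ℤ-equal? i j with i ℤ.≟ j
  ... | yes ≡.refl = just refl
  ... | no _       = nothing

  open RingSolver ℤ.+-*-rawRing (ACR.fromCommutativeRing R) ℤ⟶R ℤ-equal? public
    using (solve; _:+_; _:*_; _:-_; :-_; _:=_; con)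

module Cube where
  private variable n d : ℕ

  eqB-sound : ∀ a b → T (eqB a b) → a ≡ b
  eqB-sound false false _ = ≡.refl
  eqB-sound true  true  _ = ≡.refl

  eqB-refl : ∀ a → T (eqB a a)
  eqB-refl false = tt
  eqB-refl true  = tt

  eqVec-sound : (u v : Vec Bool n) → eqVec u v ≡ true → u ≡ v
  eqVec-sound V.[]      V.[]      _ = ≡.refl
  eqVec-sound (a V.∷ u) (b V.∷ v) e with eqB a b in a≟b
  ... | true  = ≡.cong₂ V._∷_ (eqB-sound a b (Equivalence.from T-≡ a≟b)) (eqVec-sound u v e)

  eqVec-refl : (u : Vec Bool n) → eqVec u u ≡ true
  eqVec-refl V.[]      = ≡.refl
  eqVec-refl (a V.∷ u) with eqB a a | eqB-refl a
  ... | true | _ = eqVec-refl u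

  Agree : Fin d → Vec Bool d → Vec Bool d → Set
  Agree i x y = ∀ j → j Fin.< i → V.lookup x j ≡ V.lookup y j

  agree-sym : ∀ (i : Fin d) x y → Agree i x y → Agree i y x
  agree-sym i x y x~y j j<i = ≡.sym (x~y j j<i)

  agree-mono : ∀ {i j : Fin d} x y → j Fin.< i → Agree i x y → Agree j x y
  agree-mono x y j<i x~y k k<j = x~y k (ℕP.<-trans k<j j<i)

  agreeAt : Fin d → Vec Bool d → Vec Bool d → Fin d → Bool
  agreeAt i x y j = if toℕ j ℕ.<ᵇ toℕ i then eqB (V.lookup x j) (V.lookup y j) else true

  agreeBelow-sound : ∀ (i : Fin d) x y → agreeBelow i x y ≡ true → Agree i x y
  agreeBelow-sound {d} i x y e j j<i =
    eqB-sound _ _ (if-true (ℕP.<⇒<ᵇ j<i) (All.lookup (all⁺ (agreeAt i x y) (L.allFin d) (Equivalence.from T-≡ e)) (∈-allFin j)))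
    where
    if-true : ∀ {b u} → T b → T (if b then u else true) → T u
    if-true {true} _ t = t

  agreeBelow-complete : ∀ (i : Fin d) x y → Agree i x y → agreeBelow i x y ≡ true
  agreeBelow-complete {d} i x y x~y =
    Equivalence.to T-≡ (all⁻ (agreeAt i x y) {L.allFin d} (All.tabulate (λ {j} _ → test j)))
    where
    test : ∀ j → T (agreeAt i x y j)
    test j with toℕ j ℕ.<ᵇ toℕ i in j<ᵇi
    ... | false = tt
    ... | true rewrite x~y j (ℕP.<ᵇ⇒< _ _ (Equivalence.from T-≡ j<ᵇi)) = eqB-refl (V.lookup y j)

  -- The prefix x_<i, padded with zeros: a canonical representative of the
  -- agreement class of x.
  prefix : Fin d → Vec Bool d → Vec Bool d
  prefix i x = V.tabulate (λ j → if toℕ j ℕ.<ᵇ toℕ i then V.lookup x j else false)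

  prefix-agree : ∀ (i : Fin d) x → Agree i (prefix i x) x
  prefix-agree i x j j<i
    rewrite VP.lookup∘tabulate (λ j → if toℕ j ℕ.<ᵇ toℕ i then V.lookup x j else false) j
          | Equivalence.to T-≡ (ℕP.<⇒<ᵇ j<i) = ≡.refl

  prefix-cong : ∀ (i : Fin d) x y → Agree i x y → prefix i x ≡ prefix i y
  prefix-cong i x y x~y = VP.tabulate-cong same
    where
    same : ∀ j → (if toℕ j ℕ.<ᵇ toℕ i then V.lookup x j else false)
               ≡ (if toℕ j ℕ.<ᵇ toℕ i then V.lookup y j else false)
    same j with toℕ j ℕ.<ᵇ toℕ i in j<ᵇi
    ... | true  = x~y j (ℕP.<ᵇ⇒< _ _ (Equivalence.from T-≡ j<ᵇi))
    ... | false = ≡.refl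

  prefix-idem : ∀ (i : Fin d) x → prefix i (prefix i x) ≡ prefix i x
  prefix-idem i x = prefix-cong i (prefix i x) x (prefix-agree i x)

  -- Parents of i lie below i, so X_Parents(i) is determined by X_<i.
  restr-agree : ∀ (G : DAG d) (i : Fin d) x y → Agree i x y → restr G x i ≡ restr G y i
  restr-agree G i x y x~y = map-fromList (All.map (λ {j} j<i → x~y j j<i) (parents-below G i))
    where
    map-fromList : ∀ {l} → All.All (λ j → V.lookup x j ≡ V.lookup y j) l →
                   V.map (V.lookup x) (V.fromList l) ≡ V.map (V.lookup y) (V.fromList l)
    map-fromList All.[]       = ≡.refl
    map-fromList (e All.∷ es) = ≡.cong₂ V._∷_ e (map-fromList es)

module FiniteSums {c ℓ} (R : CommutativeRing c ℓ) where
  open CommutativeRing R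
  open SetoidReasoning setoid

  private variable A B : Set

  ∑ : List A → (A → Carrier) → Carrier
  ∑ xs f = L.foldr (λ x acc → f x + acc) 0# xs

  ∑-cong : ∀ (xs : List A) {f g} → (∀ x → f x ≈ g x) → ∑ xs f ≈ ∑ xs g
  ∑-cong []       f≈g = refl
  ∑-cong (x ∷ xs) f≈g = +-cong (f≈g x) (∑-cong xs f≈g)

  ∑-0 : ∀ (xs : List A) {f} → (∀ x → f x ≈ 0#) → ∑ xs f ≈ 0#
  ∑-0 []       f≈0 = refl
  ∑-0 (x ∷ xs) f≈0 = trans (+-cong (f≈0 x) (∑-0 xs f≈0)) (+-identityʳ 0#)

  ∑-+ : ∀ (xs : List A) f g → ∑ xs (λ x → f x + g x) ≈ ∑ xs f + ∑ xs g
  ∑-+ []       f g = sym (+-identityʳ 0#)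
  ∑-+ (x ∷ xs) f g = trans (+-congˡ (∑-+ xs f g))
                           (CommSemigroupProperties.interchange +-commutativeSemigroup _ _ _ _)

  ∑-* : ∀ (xs : List A) a f → ∑ xs (λ x → a * f x) ≈ a * ∑ xs f
  ∑-* []       a f = sym (zeroʳ a)
  ∑-* (x ∷ xs) a f = trans (+-congˡ (∑-* xs a f)) (sym (distribˡ a _ _))

  ∑-affine : ∀ (xs : List A) f b g → ∑ xs (λ x → f x + b * g x) ≈ ∑ xs f + b * ∑ xs g
  ∑-affine xs f b g = trans (∑-+ xs f _) (+-congˡ (∑-* xs b g))

  ∑-swap : ∀ (xs : List A) (ys : List B) (h : A → B → Carrier) →
           ∑ xs (λ x → ∑ ys (h x)) ≈ ∑ ys (λ y → ∑ xs (λ x → h x y))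
  ∑-swap []       ys h = sym (∑-0 ys (λ _ → refl))
  ∑-swap (x ∷ xs) ys h = trans (+-congˡ (∑-swap xs ys h)) (sym (∑-+ ys (h x) _))

  ∑-cube-split : ∀ {n} (f : Vec Bool (suc n) → Carrier) →
                 ∑ (allVecs (suc n)) f ≈ ∑ (allVecs n) (λ v → f (false V.∷ v)) + ∑ (allVecs n) (λ v → f (true V.∷ v))
  ∑-cube-split {n} f = go (allVecs n)
    where
    go : ∀ vs → ∑ (L.concatMap (λ v → (false V.∷ v) ∷ (true V.∷ v) ∷ []) vs) f
              ≈ ∑ vs (λ v → f (false V.∷ v)) + ∑ vs (λ v → f (true V.∷ v))
    go []       = sym (+-identityʳ 0#)
    go (v ∷ vs) = begin
      f (false V.∷ v) + (f (true V.∷ v) + ∑ (L.concatMap _ vs) f)   ≈⟨ +-congˡ (+-congˡ (go vs)) ⟩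
      f (false V.∷ v) + (f (true V.∷ v) + (∑ vs _ + ∑ vs _))       ≈⟨ +-assoc _ _ _ ⟨
      (f (false V.∷ v) + f (true V.∷ v)) + (∑ vs _ + ∑ vs _)       ≈⟨ CommSemigroupProperties.interchange +-commutativeSemigroup _ _ _ _ ⟩
      _                                                            ∎

  ∑-cube-point : ∀ {n} (v : Vec Bool n) (f : Vec Bool n → Carrier) →
                 (∀ y → y ≢ v → f y ≈ 0#) → ∑ (allVecs n) f ≈ f v
  ∑-cube-point V.[]                 f off = +-identityʳ _
  ∑-cube-point {suc n} (false V.∷ v) f off = begin
    ∑ (allVecs (suc n)) f   ≈⟨ ∑-cube-split f ⟩
    _ + _                   ≈⟨ +-cong (∑-cube-point v _ (λ y y≢v → off _ (y≢v ∘′ VP.∷-injectiveʳ)))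
                                      (∑-0 (allVecs n) (λ y → off _ (λ ()))) ⟩
    f (false V.∷ v) + 0#    ≈⟨ +-identityʳ _ ⟩
    f (false V.∷ v)         ∎
  ∑-cube-point {suc n} (true V.∷ v) f off = begin
    ∑ (allVecs (suc n)) f   ≈⟨ ∑-cube-split f ⟩
    _ + _                   ≈⟨ +-cong (∑-0 (allVecs n) (λ y → off _ (λ ())))
                                      (∑-cube-point v _ (λ y y≢v → off _ (y≢v ∘′ VP.∷-injectiveʳ))) ⟩
    0# + f (true V.∷ v)     ≈⟨ +-identityˡ _ ⟩
    f (true V.∷ v)          ∎

module Moments {c ℓ ℓ'} (O : OrderedCommRing c ℓ ℓ') where
  open OrderedCommRing O using (commutativeRing; _≤_; isTotalOrder; +-monoˡ-≤; *-nonneg)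
  open CommutativeRing commutativeRing
  open IsTotalOrder isTotalOrder using (antisym; total) renaming (reflexive to ≤-reflexive; trans to ≤-trans)
  open RingProperties ring using (-0#≈0#; -‿distribˡ-*)
  open WithRing O
  open FiniteSums commutativeRing
  open IntegerSolver commutativeRing
  open SetoidReasoning setoid
  open Cube

  private variable A : Set

  +-mono-≤ : ∀ {a b u v} → a ≤ b → u ≤ v → (a + u) ≤ (b + v)
  +-mono-≤ {a} {b} {u} {v} a≤b u≤v =
    ≤-trans (+-monoˡ-≤ u a≤b)
      (≤-trans (≤-reflexive (+-comm b u)) (≤-trans (+-monoˡ-≤ b u≤v) (≤-reflexive (+-comm v b))))

  ∑-mono : ∀ (xs : List A) {f g} → (∀ x → f x ≤ g x) → ∑ xs f ≤ ∑ xs g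
  ∑-mono []       _   = ≤-reflexive refl
  ∑-mono (x ∷ xs) f≤g = +-mono-≤ (f≤g x) (∑-mono xs f≤g)

  ≤⇒0≤- : ∀ {u v} → u ≤ v → 0# ≤ (v - u)
  ≤⇒0≤- {u} u≤v = ≤-trans (≤-reflexive (sym (-‿inverseʳ u))) (+-monoˡ-≤ (- u) u≤v)

  0≤-⇒≤ : ∀ {u v} → 0# ≤ (v - u) → u ≤ v
  0≤-⇒≤ {u} {v} 0≤v-u =
    ≤-trans (≤-reflexive (sym (+-identityˡ u))) (≤-trans (+-monoˡ-≤ u 0≤v-u) (≤-reflexive (v-u+u v u)))
    where
    v-u+u : ∀ v u → (v - u) + u ≈ v
    v-u+u = solve 2 (λ v u → (v :- u) :+ u := v) refl

  *-monoˡ-≤ : ∀ {t a b} → 0# ≤ t → a ≤ b → (t * a) ≤ (t * b)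
  *-monoˡ-≤ {t} {a} {b} 0≤t a≤b =
    0≤-⇒≤ (≤-trans (*-nonneg 0≤t (≤⇒0≤- a≤b)) (≤-reflexive (distrib-sub t b a)))
    where
    distrib-sub : ∀ t b a → t * (b - a) ≈ t * b - t * a
    distrib-sub = solve 3 (λ t b a → t :* (b :- a) := t :* b :- t :* a) refl

  -- If t annihilates b, it annihilates every a with 0 ≤ a ≤ b: first for t ≥ 0
  -- by monotonicity, then for t ≤ 0 by applying this to - t.
  annihilate⁺ : ∀ {t a b} → 0# ≤ t → 0# ≤ a → a ≤ b → t * b ≈ 0# → t * a ≈ 0#
  annihilate⁺ 0≤t 0≤a a≤b tb≈0 = antisym (≤-trans (*-monoˡ-≤ 0≤t a≤b) (≤-reflexive tb≈0)) (*-nonneg 0≤t 0≤a)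

  annihilate : ∀ {t a b} → 0# ≤ a → a ≤ b → t * b ≈ 0# → t * a ≈ 0#
  annihilate {t} {a} {b} 0≤a a≤b tb≈0 with total 0# t
  ... | inj₁ 0≤t = annihilate⁺ 0≤t 0≤a a≤b tb≈0
  ... | inj₂ t≤0 = begin
    t * a          ≈⟨ double-negation t a ⟩
    - (- t * a)    ≈⟨ -‿cong (annihilate⁺ 0≤-t 0≤a a≤b -t*b≈0) ⟩
    - 0#           ≈⟨ -0#≈0# ⟩
    0#             ∎
    where
    double-negation : ∀ t a → t * a ≈ - (- t * a)
    double-negation = solve 2 (λ t a → t :* a := :- ((:- t) :* a)) refl
    0≤-t : 0# ≤ (- t)
    0≤-t = ≤-trans (≤⇒0≤- t≤0) (≤-reflexive (+-identityˡ (- t)))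
    -t*b≈0 : - t * b ≈ 0#
    -t*b≈0 = trans (sym (-‿distribˡ-* t b)) (trans (-‿cong tb≈0) -0#≈0#)

  ∑-cube-term : ∀ {n} (h : Vec Bool n → Carrier) → (∀ y → 0# ≤ h y) → ∀ v → h v ≤ ∑ (allVecs n) h
  ∑-cube-term {n} h 0≤h v = ≤-trans (≤-reflexive (sym (trans (∑-cube-point v at-v off) on-v))) (∑-mono (allVecs n) at-v≤h)
    where
    at-v : Vec Bool n → Carrier
    at-v y = if eqVec y v then h y else 0#
    off : ∀ y → y ≢ v → at-v y ≈ 0#
    off y y≢v with eqVec y v in y≟v
    ... | true  = ⊥-elim (y≢v (eqVec-sound y v y≟v))
    ... | false = refl
    on-v : at-v v ≈ h v
    on-v rewrite eqVec-refl v = refl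
    at-v≤h : ∀ y → at-v y ≤ h y
    at-v≤h y with eqVec y v
    ... | true  = ≤-reflexive refl
    ... | false = 0≤h y

  ind-∧ : ∀ a b → ind (a ∧ b) ≈ ind a * ind b
  ind-∧ true  b = sym (*-identityˡ _)
  ind-∧ false b = sym (zeroˡ _)

  ind-weight-nonneg : ∀ {q} b → 0# ≤ q → 0# ≤ (q * ind b)
  ind-weight-nonneg {q} true  0≤q = ≤-trans 0≤q (≤-reflexive (sym (*-identityʳ q)))
  ind-weight-nonneg {q} false _   = ≤-reflexive (sym (zeroʳ q))

  module Expectation {d} (P : Vec Bool d → Carrier) where

    Pr-as-𝔼 : ∀ E → Pr P E ≈ 𝔼 P (λ x → ind (E x))
    Pr-as-𝔼 E = ∑-cong (allVecs d) (λ x → select (E x) (P x))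
      where
      select : ∀ b q → (if b then q else 0#) ≈ q * ind b
      select true  q = sym (*-identityʳ q)
      select false q = sym (zeroʳ q)

    centred-zero : ∀ (A B : Vec Bool d → Bool) q → Pr P (λ x → A x ∧ B x) ≈ q * Pr P A →
                   𝔼 P (λ x → ind (A x) * (ind (B x) - q)) ≈ 0#
    centred-zero A B q conditional = begin
      𝔼 P (λ x → ind (A x) * (ind (B x) - q))
        ≈⟨ ∑-cong (allVecs d) (λ x → trans (expand (P x) (ind (A x)) (ind (B x)) q) (+-congʳ (*-congˡ (sym (ind-∧ (A x) (B x)))))) ⟩
      ∑ (allVecs d) (λ x → P x * ind (A x ∧ B x) + (- q) * (P x * ind (A x)))
        ≈⟨ ∑-affine (allVecs d) _ (- q) _ ⟩
      𝔼 P (λ x → ind (A x ∧ B x)) + (- q) * 𝔼 P (λ x → ind (A x))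
        ≈⟨ +-cong (sym (Pr-as-𝔼 _)) (*-congˡ (sym (Pr-as-𝔼 A))) ⟩
      Pr P (λ x → A x ∧ B x) + (- q) * Pr P A
        ≈⟨ +-congʳ conditional ⟩
      q * Pr P A + (- q) * Pr P A
        ≈⟨ cancel q (Pr P A) ⟩
      0#  ∎
      where
      expand : ∀ w a b q → w * (a * (b - q)) ≈ w * (a * b) + (- q) * (w * a)
      expand = solve 4 (λ w a b q → w :* (a :* (b :- q)) := w :* (a :* b) :+ (:- q) :* (w :* a)) refl
      cancel : ∀ q u → q * u + (- q) * u ≈ 0#
      cancel = solve 2 (λ q u → q :* u :+ (:- q) :* u := con (+ 0)) refl

  module Network {d} (G : DAG d) (P : Vec Bool d → Carrier) (p : Idx G → Carrier) where
    open Expectation P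

    I : Vec Bool d → Idx G → Carrier
    I x k = ind (inΠ G x k)

    D : Vec Bool d → Idx G → Carrier
    D x k = I x k * (ind (V.lookup x (proj₁ k)) - p k)

    F-centred : ∀ x k → F G x p k - p k ≈ D x k
    F-centred x k with inΠ G x k
    ... | true  = sym (*-identityˡ _)
    ... | false = trans (-‿inverseʳ (p k)) (sym (zeroˡ _))

    𝔼-D : IsCPT G P p → ∀ k → 𝔼 P (λ x → D x k) ≈ 0#
    𝔼-D cpt k = centred-zero (λ x → inΠ G x k) (λ x → V.lookup x (proj₁ k)) (p k) (cpt k)

    mean : sumAll P ≈ 1# → IsCPT G P p → ∀ k → Mean P (λ x → F G x p) k ≈ p k
    mean total cpt k = begin
      𝔼 P (λ x → F G x p k)
        ≈⟨ ∑-cong (allVecs d) (λ x → trans (recentre (P x) (F G x p k) (p k)) (+-congʳ (*-congˡ (F-centred x k)))) ⟩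
      ∑ (allVecs d) (λ x → P x * D x k + p k * P x)   ≈⟨ ∑-affine (allVecs d) _ (p k) P ⟩
      𝔼 P (λ x → D x k) + p k * sumAll P               ≈⟨ +-cong (𝔼-D cpt k) (*-congˡ total) ⟩
      0# + p k * 1#                                    ≈⟨ trans (+-identityˡ _) (*-identityʳ _) ⟩
      p k                                              ∎
      where
      recentre : ∀ w u v → w * u ≈ w * (u - v) + v * w
      recentre = solve 3 (λ w u v → w :* u := w :* (u :- v) :+ v :* w) refl

    -- Since the mean is p, covariances are the second moments of D.
    cov-D : sumAll P ≈ 1# → IsCPT G P p → ∀ k l → Cov P (λ x → F G x p) k l ≈ 𝔼 P (λ x → D x k * D x l)
    cov-D total cpt k l = ∑-cong (allVecs d) (λ x → *-congˡ (*-cong (deviation x k) (deviation x l)))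
      where
      deviation : ∀ x k → F G x p k - Mean P (λ x → F G x p) k ≈ D x k
      deviation x k = trans (+-congˡ (-‿cong (mean total cpt k))) (F-centred x k)

    D-square : ∀ x k → D x k * D x k ≈ (1# - p k - p k) * D x k + (p k * (1# - p k)) * I x k
    D-square x k = bernoulli (inΠ G x k) (V.lookup x (proj₁ k)) (p k)
      where
      bernoulli : ∀ a b q → (ind a * (ind b - q)) * (ind a * (ind b - q))
                            ≈ (1# - q - q) * (ind a * (ind b - q)) + (q * (1# - q)) * ind a
      bernoulli false b = solve 2 (λ y q → (con (+ 0) :* (y :- q)) :* (con (+ 0) :* (y :- q))
                            := (con (+ 1) :- q :- q) :* (con (+ 0) :* (y :- q)) :+ (q :* (con (+ 1) :- q)) :* con (+ 0)) refl (ind b)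
      bernoulli true true = solve 1 (λ q → (con (+ 1) :* (con (+ 1) :- q)) :* (con (+ 1) :* (con (+ 1) :- q))
                            := (con (+ 1) :- q :- q) :* (con (+ 1) :* (con (+ 1) :- q)) :+ (q :* (con (+ 1) :- q)) :* con (+ 1)) refl
      bernoulli true false = solve 1 (λ q → (con (+ 1) :* (con (+ 0) :- q)) :* (con (+ 1) :* (con (+ 0) :- q))
                            := (con (+ 1) :- q :- q) :* (con (+ 1) :* (con (+ 0) :- q)) :+ (q :* (con (+ 1) :- q)) :* con (+ 1)) refl

    variance : IsCPT G P p → ∀ k → 𝔼 P (λ x → D x k * D x k) ≈ Pr P (λ x → inΠ G x k) * (p k * (1# - p k))
    variance cpt k = begin
      𝔼 P (λ x → D x k * D x k)
        ≈⟨ ∑-cong (allVecs d) (λ x → trans (*-congˡ (D-square x k)) (distribute (P x) α (D x k) β (I x k))) ⟩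
      ∑ (allVecs d) (λ x → α * (P x * D x k) + β * (P x * I x k))
        ≈⟨ trans (∑-affine (allVecs d) _ β _) (+-congʳ (∑-* (allVecs d) α _)) ⟩
      α * 𝔼 P (λ x → D x k) + β * 𝔼 P (λ x → I x k)
        ≈⟨ +-cong (*-congˡ (𝔼-D cpt k)) (*-congˡ (sym (Pr-as-𝔼 _))) ⟩
      α * 0# + β * Pr P (λ x → inΠ G x k)
        ≈⟨ trans (+-congʳ (zeroʳ α)) (trans (+-identityˡ _) (*-comm β _)) ⟩
      Pr P (λ x → inΠ G x k) * β ∎
      where
      α β : Carrier
      α = 1# - p k - p k
      β = p k * (1# - p k)
      distribute : ∀ w α u β v → w * (α * u + β * v) ≈ α * (w * u) + β * (w * v)
      distribute = solve 5 (λ w α u β v → w :* (α :* u :+ β :* v) := α :* (w :* u) :+ β :* (w :* v)) refl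

    -- Distinct parent configurations of the same node give disjoint events.
    same-node : ∀ i {a b} → a ≢ b → 𝔼 P (λ x → D x (i , a) * D x (i , b)) ≈ 0#
    same-node i {a} {b} a≢b = ∑-0 (allVecs d) λ x →
      disjoint (inΠ G x (i , a)) (inΠ G x (i , b)) (P x) _ _
        (λ x∈Πa x∈Πb → a≢b (≡.trans (≡.sym (eqVec-sound (restr G x i) a x∈Πa)) (eqVec-sound (restr G x i) b x∈Πb)))
      where
      disjoint : ∀ α β w u v → (α ≡ true → β ≡ true → ⊥) → w * ((ind α * u) * (ind β * v)) ≈ 0#
      disjoint true  true  w u v both = ⊥-elim (both ≡.refl ≡.refl)
      disjoint false β     w u v _    = solve 4 (λ w u b v → w :* ((con (+ 0) :* u) :* (b :* v)) := con (+ 0)) refl w u (ind β) v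
      disjoint true  false w u v _    = solve 3 (λ w u v → w :* ((con (+ 1) :* u) :* (con (+ 0) :* v)) := con (+ 0)) refl w u v

    DependsBelow : Fin d → (Vec Bool d → Carrier) → Set ℓ
    DependsBelow i c = ∀ x y → Agree i x y → c x ≈ c y

    module Node (i : Fin d) (g : Vec Bool (npar G i) → Carrier)
                (bn : ∀ y → Pr P (λ x → agreeBelow i x y ∧ V.lookup x i)
                              ≈ g (restr G y i) * Pr P (λ x → agreeBelow i x y)) where

      Xᵢ : Vec Bool d → Carrier
      Xᵢ x = ind (V.lookup x i)

      -- The sum over x is regrouped along the fibres {x : x_<i = y_<i} of the
      -- prefix map, indexed by their representatives y = prefix i y; on each
      -- fibre c and g(X_Parents(i)) are constant and the network condition applies.
      tower : ∀ c → DependsBelow i c → 𝔼 P (λ x → c x * (Xᵢ x - g (restr G x i))) ≈ 0#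
      tower c c-below = begin
        𝔼 P (λ x → c x * (Xᵢ x - g (restr G x i)))        ≈⟨ ∑-cong (allVecs d) unfold ⟨
        ∑ (allVecs d) (λ x → ∑ (allVecs d) (λ y → w y * Q y x))   ≈⟨ ∑-swap (allVecs d) (allVecs d) (λ x y → w y * Q y x) ⟩
        ∑ (allVecs d) (λ y → ∑ (allVecs d) (λ x → w y * Q y x))   ≈⟨ ∑-cong (allVecs d) (λ y → ∑-* (allVecs d) (w y) (Q y)) ⟩
        ∑ (allVecs d) (λ y → w y * ∑ (allVecs d) (Q y))           ≈⟨ ∑-0 (allVecs d) (λ y → trans (*-congˡ (fibre y)) (zeroʳ _)) ⟩
        0#                                                       ∎
        where
        -- the weight c, kept only at representatives
        w : Vec Bool d → Carrier
        w y = ind (eqVec y (prefix i y)) * c y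

        Q : Vec Bool d → Vec Bool d → Carrier
        Q y x = P x * (ind (agreeBelow i x y) * (Xᵢ x - g (restr G y i)))

        fibre : ∀ y → ∑ (allVecs d) (Q y) ≈ 0#
        fibre y = centred-zero (λ x → agreeBelow i x y) (λ x → V.lookup x i) (g (restr G y i)) (bn y)

        off : ∀ x y → y ≢ prefix i x → w y * Q y x ≈ 0#
        off x y y≢x̂ with eqVec y (prefix i y) in y-rep | agreeBelow i x y in x~y
        ... | false | _     = trans (*-congʳ (zeroˡ (c y))) (zeroˡ _)
        ... | true  | false = trans (*-congˡ (*-congˡ (zeroˡ _))) (trans (*-congˡ (zeroʳ (P x))) (zeroʳ _))
        ... | true  | true  = ⊥-elim (y≢x̂ (≡.trans (eqVec-sound y _ y-rep)
                                      (≡.sym (prefix-cong i x y (agreeBelow-sound i x y x~y)))))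

        on : ∀ x → w (prefix i x) * Q (prefix i x) x ≈ P x * (c x * (Xᵢ x - g (restr G x i)))
        on x = begin
          w x̂ * Q x̂ x
            ≈⟨ *-cong (*-cong (reflexive (≡.cong ind x̂-rep)) (c-below x̂ x (prefix-agree i x)))
                      (*-congˡ (*-cong (reflexive (≡.cong ind x~x̂))
                                       (+-congˡ (-‿cong (reflexive (≡.cong g (restr-agree G i x̂ x (prefix-agree i x)))))))) ⟩
          (1# * c x) * (P x * (1# * (Xᵢ x - g (restr G x i))))
            ≈⟨ regroup (c x) (P x) _ ⟩
          P x * (c x * (Xᵢ x - g (restr G x i)))  ∎
          where
          x̂ = prefix i x
          x̂-rep : eqVec x̂ (prefix i x̂) ≡ true
          x̂-rep = ≡.subst (λ z → eqVec x̂ z ≡ true) (≡.sym (prefix-idem i x)) (eqVec-refl x̂)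
          x~x̂ : agreeBelow i x x̂ ≡ true
          x~x̂ = agreeBelow-complete i x x̂ (agree-sym i x̂ x (prefix-agree i x))
          regroup : ∀ c w u → (1# * c) * (w * (1# * u)) ≈ w * (c * u)
          regroup = solve 3 (λ c w u → (con (+ 1) :* c) :* (w :* (con (+ 1) :* u)) := w :* (c :* u)) refl

        unfold : ∀ x → ∑ (allVecs d) (λ y → w y * Q y x) ≈ P x * (c x * (Xᵢ x - g (restr G x i)))
        unfold x = trans (∑-cube-point (prefix i x) _ (off x)) (on x)

      -- For k = (i,a) and c depending on X_<i:  E[c D_k] = (g(a) - p_k) E[c 1_Πk],
      -- because on Π_k the parents of i are in configuration a.
      weighted-D : ∀ a c → DependsBelow i c →
                   𝔼 P (λ x → c x * D x (i , a)) ≈ (g a - p (i , a)) * 𝔼 P (λ x → c x * I x (i , a))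
      weighted-D a c c-below = begin
        𝔼 P (λ x → c x * D x k)
          ≈⟨ ∑-cong (allVecs d) (λ x → trans (split (P x) (c x) (I x k) (Xᵢ x) (p k) (g a)) (+-congʳ (on-Π x))) ⟩
        ∑ (allVecs d) (λ x → P x * ((c x * I x k) * (Xᵢ x - g (restr G x i))) + gap * (P x * (c x * I x k)))
          ≈⟨ ∑-affine (allVecs d) _ gap _ ⟩
        𝔼 P (λ x → (c x * I x k) * (Xᵢ x - g (restr G x i))) + gap * 𝔼 P (λ x → c x * I x k)
          ≈⟨ +-congʳ (tower (λ x → c x * I x k) cI-below) ⟩
        0# + gap * 𝔼 P (λ x → c x * I x k)
          ≈⟨ +-identityˡ _ ⟩
        gap * 𝔼 P (λ x → c x * I x k) ∎
        where
        k : Idx G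
        k = (i , a)
        gap : Carrier
        gap = g a - p k

        split : ∀ w c ι y q γ → w * (c * (ι * (y - q))) ≈ w * ((c * ι) * (y - γ)) + (γ - q) * (w * (c * ι))
        split = solve 6 (λ w c ι y q γ → w :* (c :* (ι :* (y :- q)))
                                      := w :* ((c :* ι) :* (y :- γ)) :+ (γ :- q) :* (w :* (c :* ι))) refl

        on-Π : ∀ x → P x * ((c x * I x k) * (Xᵢ x - g a)) ≈ P x * ((c x * I x k) * (Xᵢ x - g (restr G x i)))
        on-Π x with inΠ G x k in x∈Π
        ... | true  = *-congˡ (*-congˡ (+-congˡ (-‿cong (reflexive (≡.cong g (≡.sym (eqVec-sound (restr G x i) a x∈Π)))))))
        ... | false = trans (outside (Xᵢ x - g a)) (sym (outside (Xᵢ x - g (restr G x i))))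
          where
          outside : ∀ u → P x * ((c x * 0#) * u) ≈ 0#
          outside u = trans (*-congˡ (trans (*-congʳ (zeroʳ (c x))) (zeroˡ u))) (zeroʳ (P x))

        cI-below : DependsBelow i (λ x → c x * I x k)
        cI-below x y x~y = *-cong (c-below x y x~y) (reflexive (≡.cong (λ r → ind (eqVec r a)) (restr-agree G i x y x~y)))

      -- Positivity forces g(a) = p_k wherever P charges Π_k.
      null-gap : IsCPT G P p → (∀ x → 0# ≤ P x) → ∀ a x → (g a - p (i , a)) * (P x * I x (i , a)) ≈ 0#
      null-gap cpt P≥0 a x =
        annihilate (ind-weight-nonneg (inΠ G x k) (P≥0 x)) (∑-cube-term h (λ y → ind-weight-nonneg (inΠ G y k) (P≥0 y)) x) total-gap
        where
        k : Idx G
        k = (i , a)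
        h : Vec Bool d → Carrier
        h x = P x * I x k
        total-gap : (g a - p k) * ∑ (allVecs d) h ≈ 0#
        total-gap = begin
          (g a - p k) * ∑ (allVecs d) h               ≈⟨ *-congˡ (∑-cong (allVecs d) (λ x → *-congˡ (*-identityˡ (I x k)))) ⟨
          (g a - p k) * 𝔼 P (λ x → 1# * I x k)        ≈⟨ weighted-D a (λ _ → 1#) (λ _ _ _ → refl) ⟨
          𝔼 P (λ x → 1# * D x k)                      ≈⟨ ∑-cong (allVecs d) (λ x → *-congˡ (*-identityˡ (D x k))) ⟩
          𝔼 P (λ x → D x k)                           ≈⟨ 𝔼-D cpt k ⟩
          0#                                          ∎

      -- For l = (j,b) with j < i, D_l depends on X_<i, hence E[D_l D_k] = 0.
      cross : IsCPT G P p → (∀ x → 0# ≤ P x) → ∀ a {j} b → j Fin.< i →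
              𝔼 P (λ x → D x (j , b) * D x (i , a)) ≈ 0#
      cross cpt P≥0 a {j} b j<i = begin
        𝔼 P (λ x → D x l * D x k)                  ≈⟨ weighted-D a (λ x → D x l) Dₗ-below ⟩
        (g a - p k) * 𝔼 P (λ x → D x l * I x k)    ≈⟨ ∑-* (allVecs d) (g a - p k) _ ⟨
        ∑ (allVecs d) (λ x → (g a - p k) * (P x * (D x l * I x k)))
          ≈⟨ ∑-0 (allVecs d) (λ x → trans (pull (g a - p k) (P x) (D x l) (I x k))
                                          (trans (*-congˡ (null-gap cpt P≥0 a x)) (zeroʳ (D x l)))) ⟩
        0#                                         ∎
        where
        k l : Idx G
        k = (i , a)
        l = (j , b)
        pull : ∀ t w e ι → t * (w * (e * ι)) ≈ e * (t * (w * ι))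
        pull = solve 4 (λ t w e ι → t :* (w :* (e :* ι)) := e :* (t :* (w :* ι))) refl
        Dₗ-below : DependsBelow i (λ x → D x l)
        Dₗ-below x y x~y = reflexive (≡.cong₂ (λ r z → ind (eqVec r b) * (ind z - p l))
                                       (restr-agree G j x y (agree-mono x y j<i x~y)) (x~y j j<i))

    cross-nodes : IsBayesNet G P → IsCPT G P p → ∀ {i j} a b → j Fin.< i →
                  𝔼 P (λ x → D x (j , b) * D x (i , a)) ≈ 0#
    cross-nodes ((P≥0 , _) , node) cpt {i} a b j<i = Node.cross i (proj₁ (node i)) (proj₂ (node i)) cpt P≥0 a b j<i

    uncorrelated : IsBayesNet G P → IsCPT G P p → ∀ k l → k ≢ l → Cov P (λ x → F G x p) k l ≈ 0#
    uncorrelated bayes cpt (i , a) (j , b) k≢l with FinP.<-cmp i j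
    ... | tri< i<j _ _ = trans (cov-D (proj₂ (proj₁ bayes)) cpt (i , a) (j , b)) (cross-nodes bayes cpt b a i<j)
    ... | tri≈ _ ≡.refl _ = trans (cov-D (proj₂ (proj₁ bayes)) cpt (i , a) (i , b)) (same-node i (k≢l ∘′ ≡.cong (i ,_)))
    ... | tri> _ _ j<i = trans (cov-D (proj₂ (proj₁ bayes)) cpt (i , a) (j , b))
                               (trans (∑-cong (allVecs d) (λ x → *-congˡ (*-comm (D x (i , a)) (D x (j , b)))))
                                      (cross-nodes bayes cpt a b j<i))

lemma2p6 : ∀ {c ℓ ℓ'} (O : OrderedCommRing c ℓ ℓ') {d} (G : DAG d)
             (P : Vec Bool d → CommutativeRing.Carrier (OrderedCommRing.commutativeRing O))
             (p : Idx G → CommutativeRing.Carrier (OrderedCommRing.commutativeRing O)) →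
             let open CommutativeRing (OrderedCommRing.commutativeRing O)
                 open WithRing O
             in IsBayesNet G P → IsCPT G P p →
                (∀ k → Mean P (λ x → F G x p) k ≈ p k)
                × (∀ k → Cov P (λ x → F G x p) k k
                           ≈ Pr P (λ x → inΠ G x k) * (p k * (1# - p k)))
                × (∀ k l → k ≢ l → Cov P (λ x → F G x p) k l ≈ 0#)
lemma2p6 O G P p bayes cpt =
    mean total cpt
  , (λ k → trans (cov-D total cpt k k) (variance cpt k))
  , uncorrelated bayes cpt
  where
  open CommutativeRing (OrderedCommRing.commutativeRing O) using (_≈_; 1#; trans)
  open WithRing O using (sumAll)
  open Moments.Network O G P p
  total : sumAll P ≈ 1#
  total = proj₂ (proj₁ bayes)
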